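{- Let $F$ be a face of a $z$-knotted triangulation $\Gamma$ whose $z$-monodromy $M_F$ is the identity, and let $F'$ be a face of a tetrahedron $\Gamma'$ (the triangulation of $\mathbb S^2$ with four vertices). Then there exists a special homeomorphism $g:\partial F\to\partial F'$ such that the connected sum $\Gamma\#_g\Gamma'$ is $z$-knotted and each of the three faces of $\Gamma\#_g\Gamma'$ coming from the faces of $\Gamma'$ distinct from $F'$ has $z$-monodromy of type (M4).
   Context: A triangulation is a connected simple finite graph embedded in a connected closed $2$-dimensional surface such that every face (closure of a component of the complement) is a closed $2$-disc with exactly three edges, every edge lies in exactly two distinct faces, and two distinct faces meet in an edge, a vertex, or not at all. Two distinct edges are adjacent if they share a vertex and lie in a common face. A zigzag is a sequence of edges $(e_i)_{i\in\mathbb N}$ with $e_i,e_{i+1}$ adjacent and the face containing $e_i,e_{i+1}$ distinct from the face containing $e_{i+1},e_{i+2}$, for all $i$; it is periodic and regarded as a cyclic sequence; written as a cyclic sequence of vertices, each passage through an edge has a direction. Its reverse is also a zigzag. A triangulation is $z$-knotted if it has exactly one pair of zigzags $\{Z,Z^{ -1}\}$. For a face $F$ with vertices $a,b,c$, $\Omega(F)=\{ab,bc,ca,ac,cb,ba\}$ (oriented edges), $-e$ is the reverse of $e$, $D_F=(ab,bc,ca)(ac,cb,ba)$. The $z$-monodromy $M_F$: for $e\in\Omega(F)$ take $e_0$ with $D_F(e_0)=e$ and the zigzag $Z$ containing consecutive oriented edges $e_0,e$; $M_F(e)$ is the first element of $\Omega(F)$ occurring in $Z$ after $e$. Type (M4):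 $M_F=(e_1,-e_2)(e_2,-e_1)$ where $(e_1,e_2,e_3)$ is one of the cycles of $D_F$ ($e_3,-e_3$ fixed). A special homeomorphism $g:\partial F\to\partial F'$ is a homeomorphism sending vertices to vertices; $\Gamma\#_g\Gamma'$ is obtained by removing the interiors of $F,F'$ and gluing boundaries via $g$ (vertices $v$ and $g(v)$ identified, corresponding edges identified). -}

module Defs where

open import Data.Nat using (ℕ; suc)
open import Data.Fin using (Fin; inject₁; fromℕ; _≟_)
open import Data.Product using (Σ; Σ-syntax; ∃; ∃-syntax; _×_; _,_)
open import Data.Sum using (_⊎_)
open import Data.Bool using (if_then_else_)
open import Relation.Nullary using (¬_)
open import Relation.Nullary.Decidable using (⌊_⌋)
open import Relation.Binary.PropositionalEquality using (_≡_; _≢_)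
open import Relation.Binary.Construct.Closure.ReflexiveTransitive using (Star)

-- Combinatorial face structures on the vertex set Fin n.
-- A face is recorded as a predicate on ordered triples of vertices
-- (closed under permutations, see Triangulation below).

FacePred : ℕ → Set₁
FacePred n = Fin n → Fin n → Fin n → Set

Adj : {n : ℕ} → FacePred n → Fin n → Fin n → Set
Adj {n} Face u v = ∃[ w ] Face u v w

-- A triangulation of a connected closed surface, described combinatorially:
-- faces are 3-sets of distinct vertices, every edge lies in exactly two
-- distinct faces, the link of every vertex is connected (hence a single
-- cycle, so the star of each vertex is a disc), the 1-skeleton is connected,
-- and there is at least one face.
record Triangulation : Set₁ where
  field
    n          : ℕ
    Face       : FacePred n
    face-distinct : ∀ {x y z} → Face x y z → x ≢ y × y ≢ z × x ≢ z
    face-rot   : ∀ {x y z} → Face x y z → Face y z x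
    face-swap  : ∀ {x y z} → Face x y z → Face y x z
    edge-two   : ∀ {x y z} → Face x y z →
                 Σ[ w ∈ Fin n ] (w ≢ x × Face w y z ×
                   (∀ u → Face u y z → u ≡ x ⊎ u ≡ w))
    link-connected : ∀ v x y → Adj Face v x → Adj Face v y →
                     Star (Face v) x y
    connected  : ∀ u v → Star (Adj Face) u v
    nonempty   : Σ[ x ∈ Fin n ] Σ[ y ∈ Fin n ] Σ[ z ∈ Fin n ] Face x y z

-- A zigzag, written as a cyclic sequence of vertices
-- v₀ v₁ v₂ …, is determined by any "flag" (v_i , v_{i+1} , v_{i+2})
-- (three consecutive vertices, forming a face); the next flag is
-- (v_{i+1} , v_{i+2} , v_{i+3}) where v_{i+3} is the third vertex of the
-- other face containing the edge v_{i+1}v_{i+2}.  Zigzags correspond to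
-- orbits of this step on flags.

Flag : ℕ → Set
Flag n = Fin n × Fin n × Fin n

IsFlag : {n : ℕ} → FacePred n → Flag n → Set
IsFlag Face (x , y , z) = Face x y z

Step : {n : ℕ} → FacePred n → Flag n → Flag n → Set
Step Face (x , y , z) (y' , z' , w) = y' ≡ y × z' ≡ z × Face y z w × w ≢ x

-- the flag of the reversed zigzag
rev : {n : ℕ} → Flag n → Flag n
rev (x , y , z) = (z , y , x)

edge : {n : ℕ} → Flag n → Fin n × Fin n
edge (x , y , z) = (y , z)

-- z-knotted: there is a zigzag Z such that every zigzag is Z or Z⁻¹
ZKnotted : (n : ℕ) → FacePred n → Set
ZKnotted n Face =
  Σ[ s ∈ Flag n ] (IsFlag Face s ×
    (∀ t → IsFlag Face t → Star (Step Face) s t ⊎ Star (Step Face) (rev s) t))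

InF : {n : ℕ} → Fin n → Fin n → Fin n → Fin n → Set
InF a b c u = u ≡ a ⊎ u ≡ b ⊎ u ≡ c

InΩ : {n : ℕ} → Fin n → Fin n → Fin n → Fin n × Fin n → Set
InΩ a b c (x , y) = InF a b c x × InF a b c y × x ≢ y

-- FirstReturn Face a b c s e : following the zigzag from the flag s,
-- the first oriented edge of Ω(F) occurring strictly after edge s is e.
data FirstReturn {n : ℕ} (Face : FacePred n) (a b c : Fin n)
     : Flag n → Fin n × Fin n → Set where
  here  : ∀ {s t} → Step Face s t → InΩ a b c (edge t) →
          FirstReturn Face a b c s (edge t)
  there : ∀ {s t e} → Step Face s t → ¬ InΩ a b c (edge t) →
          FirstReturn Face a b c t e → FirstReturn Face a b c s e

-- For e = xy ∈ Ω(F) with third vertex w of F, D_F(wx) = xy, so the zigzag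
-- containing consecutive wx, xy is the one through the flag (w , x , y).
-- M a b c (w , x , y) e  means  M_F(xy) = e.
M : {n : ℕ} → FacePred n → Fin n → Fin n → Fin n → Flag n → Fin n × Fin n → Set
M Face a b c s e = FirstReturn Face a b c s e

MonoIdentity : (n : ℕ) → FacePred n → Fin n → Fin n → Fin n → Set
MonoIdentity n Face a b c =
  M Face a b c (c , a , b) (a , b) × M Face a b c (a , b , c) (b , c) ×
  M Face a b c (b , c , a) (c , a) × M Face a b c (b , a , c) (a , c) ×
  M Face a b c (a , c , b) (c , b) × M Face a b c (c , b , a) (b , a)

-- (M4) with respect to the D_F-cycle (e₁,e₂,e₃) = (xy, yz, zx):
-- M_F = (e₁,-e₂)(e₂,-e₁), e₃ and -e₃ fixed.
M4wrt : {n : ℕ} → FacePred n → Fin n → Fin n → Fin n →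
        Fin n → Fin n → Fin n → Set
M4wrt Face a b c x y z =
  M Face a b c (z , x , y) (z , y) ×   -- e₁ ↦ -e₂
  M Face a b c (x , z , y) (x , y) ×   -- -e₂ ↦ e₁
  M Face a b c (x , y , z) (y , x) ×   -- e₂ ↦ -e₁
  M Face a b c (z , y , x) (y , z) ×   -- -e₁ ↦ e₂
  M Face a b c (y , z , x) (z , x) ×   -- e₃ ↦ e₃
  M Face a b c (y , x , z) (x , z)     -- -e₃ ↦ -e₃

-- The cycles of D_F are (ab,bc,ca) and (ac,cb,ba); the choices of
-- (e₁,e₂,e₃) among their rotations give (x,y,z) ranging over all six
-- orderings of (a,b,c).
TypeM4 : (n : ℕ) → FacePred n → Fin n → Fin n → Fin n → Set
TypeM4 n Face a b c =
  M4wrt Face a b c a b c ⊎ M4wrt Face a b c b c a ⊎ M4wrt Face a b c c a b ⊎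
  M4wrt Face a b c a c b ⊎ M4wrt Face a b c c b a ⊎ M4wrt Face a b c b a c

TetFace : FacePred 4
TetFace u v w = u ≢ v × v ≢ w × u ≢ w

-- F = {a,b,c} face of Γ, F' = {a',b',c'} face of the tetrahedron, and the
-- special homeomorphism g : ∂F → ∂F' is given (up to the only data that
-- matters combinatorially) by its vertex bijection a ↦ p, b ↦ q, c ↦ r.
-- Vertex set of the sum: Fin (suc n); old vertices via inject₁, the
-- remaining tetrahedron vertex becomes fromℕ n.

module ConnSum (n : ℕ) (Face : FacePred n) (a b c : Fin n)
               (a' b' c' p q r : Fin 4) where

  -- image of a tetrahedron vertex in the sum (v ∈ F' identified with g⁻¹ v)
  φ : Fin 4 → Fin (suc n)
  φ v = if ⌊ v ≟ p ⌋ then inject₁ a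
        else if ⌊ v ≟ q ⌋ then inject₁ b
        else if ⌊ v ≟ r ⌋ then inject₁ c
        else fromℕ n

  SumFace : FacePred (suc n)
  SumFace x y z =
    (Σ[ u ∈ Fin n ] Σ[ v ∈ Fin n ] Σ[ w ∈ Fin n ]
       (Face u v w × ¬ (InF a b c u × InF a b c v × InF a b c w) ×
        x ≡ inject₁ u × y ≡ inject₁ v × z ≡ inject₁ w))
    ⊎
    (Σ[ u ∈ Fin 4 ] Σ[ v ∈ Fin 4 ] Σ[ w ∈ Fin 4 ]
       (TetFace u v w × ¬ (InF a' b' c' u × InF a' b' c' v × InF a' b' c' w) ×
        x ≡ φ u × y ≡ φ v × z ≡ φ w))

IsBij : Fin 4 → Fin 4 → Fin 4 → Fin 4 → Fin 4 → Fin 4 → Set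
IsBij a' b' c' p q r =
  TetFace p q r × InF a' b' c' p × InF a' b' c' q × InF a' b' c' r

module Submission where

-- We take the special homeomorphism g : a ↦ a', b ↦ b', c ↦ c'; the fourth
-- tetrahedron vertex becomes a new vertex D (the apex), and the sum has the
-- three new faces {y,z,D} for the edges yz of F.
--
-- 1. General zigzag theory on a triangulation: steps are deterministic and
--    injective on a finite set of flags, so every zigzag is a cycle; hence in
--    a z-knotted triangulation any flag t is reached from any flag f or from
--    its reverse.  We also record how first returns to Ω(F) compose along
--    zigzag segments and that they only depend on the vertex set of F.
-- 2. In the sum, M_F = id says: the zigzag entering Γ through the oriented
--    edge yz of F (coming from the apex) comes back through yz itself
--    ('crossing').  Together with two steps around the apex, this describes
--    the zigzags through the 18 new flags explicitly: they form the single
--    zigzag of the base flag (D,a,b) and its reverse.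
-- 3. Flags of old faces are reached by following Γ's unique zigzag pair,
--    leaving F through the apex (reachOuter); so the sum is z-knotted.
-- 4. The same explicit description gives the first returns for each new face
--    {y,z,D}, which are of type (M4).

open import Defs
open import Data.Nat using (ℕ; zero; suc; _+_; _*_)
open import Data.Nat.Properties using (n<1+n; +-suc; m≤n⇒∃[o]m+o≡n)
open import Data.Fin using (Fin; toℕ; combine; inject₁; fromℕ; _≟_)
open import Data.Fin.Properties
  using (pigeonhole; combine-injective; inject₁-injective; fromℕ≢inject₁; all?; any?)
open import Data.Product using (Σ; Σ-syntax; _×_; _,_; proj₁; proj₂)
open import Data.Sum using (_⊎_; inj₁; inj₂; [_,_])
open import Data.Empty using (⊥-elim)
open import Data.Unit using (tt)
open import Data.Bool using (true; false)
open import Function using (_$_)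
open import Relation.Binary.Construct.Closure.ReflexiveTransitive using (Star; ε; _◅_; _◅◅_)
open import Relation.Binary.PropositionalEquality
  using (_≡_; _≢_; refl; sym; trans; cong; subst; subst₂; ≢-sym)
open import Relation.Nullary using (¬_; Dec; yes; no)
open import Relation.Nullary.Decidable
  using (⌊_⌋; toWitness; ¬?; _×-dec_; _⊎-dec_; _→-dec_; isYes≗does; dec-true; dec-false)

-- Zigzags of an arbitrary triangulation

module Zigzags (Γ : Triangulation) where
  open Triangulation Γ

  face-rot² : ∀ {x y z} → Face x y z → Face z x y
  face-rot² f = face-rot (face-rot f)

  step-flag : ∀ {s t} → Step Face s t → IsFlag Face t
  step-flag (refl , refl , f , _) = f

  successor : ∀ {s} → IsFlag Face s → Σ[ t ∈ Flag n ] Step Face s t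
  successor {x , y , z} f with edge-two f
  ... | w , w≢x , fw , _ = (y , z , w) , refl , refl , face-rot fw , w≢x

  -- each flag has a unique successor, by uniqueness of the other face on an edge
  step-deterministic : ∀ {s t t'} → IsFlag Face s → Step Face s t → Step Face s t' → t ≡ t'
  step-deterministic {x , y , z} {.y , .z , w} {.y , .z , w'} f
    (refl , refl , fw , w≢x) (refl , refl , fw' , w'≢x) with edge-two f
  ... | _ , _ , _ , unique with unique w (face-rot² fw) | unique w' (face-rot² fw')
  ... | inj₁ w≡x | _         = ⊥-elim (w≢x w≡x)
  ... | inj₂ _   | inj₁ w'≡x = ⊥-elim (w'≢x w'≡x)
  ... | inj₂ w≡o | inj₂ w'≡o = cong (λ u → y , z , u) (trans w≡o (sym w'≡o))

  step-injective : ∀ {s s' t} → IsFlag Face s → IsFlag Face s' →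
                   Step Face s t → Step Face s' t → s ≡ s'
  step-injective {x , y , z} {x' , .y , .z} {.y , .z , w} f f'
    (refl , refl , fw , w≢x) (refl , refl , _ , w≢x') with edge-two (face-rot² fw)
  ... | _ , _ , _ , unique with unique x f | unique x' f'
  ... | inj₁ x≡w | _          = ⊥-elim (w≢x (sym x≡w))
  ... | inj₂ _   | inj₁ x'≡w  = ⊥-elim (w≢x' (sym x'≡w))
  ... | inj₂ x≡o | inj₂ x'≡o  = cong (λ u → u , y , z) (trans x≡o (sym x'≡o))

  Flagged : Set
  Flagged = Σ (Flag n) (IsFlag Face)

  next : Flagged → Flagged
  next (s , f) = proj₁ (successor f) , step-flag (proj₂ (successor f))

  walk : ℕ → Flagged → Flagged
  walk zero    s = s
  walk (suc k) s = walk k (next s)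

  walk-path : ∀ k s → Star (Step Face) (proj₁ s) (proj₁ (walk k s))
  walk-path zero    s       = ε
  walk-path (suc k) (s , f) = proj₂ (successor f) ◅ walk-path k (next (s , f))

  walk-next : ∀ k s → walk (suc k) s ≡ next (walk k s)
  walk-next zero    s = refl
  walk-next (suc k) s = walk-next k (next s)

  next-injective : ∀ u v → proj₁ (next u) ≡ proj₁ (next v) → proj₁ u ≡ proj₁ v
  next-injective (u , fu) (v , fv) e = step-injective fu fv (proj₂ (successor fu))
    (subst (Step Face v) (sym e) (proj₂ (successor fv)))

  walk-cancel : ∀ i k s → proj₁ (walk i s) ≡ proj₁ (walk (i + k) s) → proj₁ (walk k s) ≡ proj₁ s
  walk-cancel zero    k s e = sym e
  walk-cancel (suc i) k s e = next-injective (walk k s) s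
    (trans (sym (cong proj₁ (walk-next k s))) (walk-cancel i k (next s) e))

  encode : Flag n → Fin (n * (n * n))
  encode (x , y , z) = combine x (combine y z)

  encode-injective : ∀ s t → encode s ≡ encode t → s ≡ t
  encode-injective (x , y , z) (x' , y' , z') e
    with combine-injective x (combine y z) x' (combine y' z') e
  ... | refl , e' with combine-injective y z y' z' e'
  ... | refl , refl = refl

  -- every zigzag is periodic (pigeonhole on the n³ possible flags)
  periodic : ∀ s → Σ[ k ∈ ℕ ] proj₁ (walk (suc k) s) ≡ proj₁ s
  periodic s with pigeonhole (n<1+n (n * (n * n))) (λ i → encode (proj₁ (walk (toℕ i) s)))
  ... | i , j , i<j , same with m≤n⇒∃[o]m+o≡n i<j
  ... | k , i+1+k≡j = k , walk-cancel (toℕ i) (suc k) s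
    (trans (encode-injective _ _ same)
           (cong (λ m → proj₁ (walk m s)) (sym (trans (+-suc (toℕ i) k) i+1+k≡j))))

  step-returns : ∀ {s t} → IsFlag Face s → Step Face s t → Star (Step Face) t s
  step-returns {s} {t} f st with periodic (s , f)
  ... | k , back = subst₂ (Star (Step Face)) (step-deterministic f (proj₂ (successor f)) st) back
                     (walk-path k (next (s , f)))

  -- zigzags are cycles, so reachability is symmetric
  star-symmetric : ∀ {s t} → IsFlag Face s → Star (Step Face) s t → Star (Step Face) t s
  star-symmetric f ε          = ε
  star-symmetric f (st ◅ p) = star-symmetric (step-flag st) p ◅◅ step-returns f st

  rev-flag : ∀ {s} → IsFlag Face s → IsFlag Face (rev s)
  rev-flag f = face-swap (face-rot f)

  rev-path : ∀ {s t} → IsFlag Face s → Star (Step Face) s t → Star (Step Face) (rev t) (rev s)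
  rev-path f ε = ε
  rev-path {x , y , z} f ((refl , refl , fw , w≢x) ◅ p) =
    rev-path fw p ◅◅ ((refl , refl , rev-flag f , ≢-sym w≢x) ◅ ε)

  knotted-connects : ZKnotted n Face → ∀ {f t} → IsFlag Face f → IsFlag Face t →
                     Star (Step Face) f t ⊎ Star (Step Face) (rev f) t
  knotted-connects (s , fs , reach) {f} {t} ff ft with reach f ff | reach t ft
  ... | inj₁ p | inj₁ q = inj₁ (star-symmetric fs p ◅◅ q)
  ... | inj₁ p | inj₂ q = inj₂ (rev-path fs p ◅◅ q)
  ... | inj₂ p | inj₂ q = inj₁ (star-symmetric (rev-flag fs) p ◅◅ q)
  ... | inj₂ p | inj₁ q = inj₂ (rev-path (rev-flag fs) p ◅◅ q)

-- First returns along zigzag segments, for an arbitrary face predicate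

module _ {m : ℕ} where

  data Passage (Face : FacePred m) (P : Flag m → Set) : Flag m → Flag m → Set where
    last : ∀ {X Y} → Step Face X Y → Passage Face P X Y
    _∷_  : ∀ {X Y Z} → Step Face X Y × P Y → Passage Face P Y Z → Passage Face P X Z

  passage-star : ∀ {Face P X Y} → Passage Face P X Y → Star (Step Face) X Y
  passage-star (last st)       = st ◅ ε
  passage-star ((st , _) ∷ p) = st ◅ passage-star p

  passage-map : ∀ {Face P Q X Y} → (∀ {Z} → P Z → Q Z) → Passage Face P X Y → Passage Face Q X Y
  passage-map f (last st)        = last st
  passage-map f ((st , pz) ∷ p) = (st , f pz) ∷ passage-map f p

  AvoidsΩ : Fin m → Fin m → Fin m → Flag m → Set
  AvoidsΩ a b c Y = ¬ InΩ a b c (edge Y)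

  firstReturn-through : ∀ {Face a b c X Y e} → Passage Face (AvoidsΩ a b c) X Y →
    AvoidsΩ a b c Y → FirstReturn Face a b c Y e → FirstReturn Face a b c X e
  firstReturn-through (last st)         nY r = there st nY r
  firstReturn-through ((st , nZ) ∷ p) nY r = there st nZ (firstReturn-through p nY r)

  firstReturn-at : ∀ {Face a b c X Y} → Passage Face (AvoidsΩ a b c) X Y →
    InΩ a b c (edge Y) → FirstReturn Face a b c X (edge Y)
  firstReturn-at (last st)         iY = here st iY
  firstReturn-at ((st , nZ) ∷ p) iY = there st nZ (firstReturn-at p iY)

  SameFace : Fin m → Fin m → Fin m → Fin m → Fin m → Fin m → Set
  SameFace a b c a' b' c' =
    (∀ {u} → InF a b c u → InF a' b' c' u) × (∀ {u} → InF a' b' c' u → InF a b c u)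

  firstReturn-relabel : ∀ {Face a b c a' b' c' s e} → SameFace a b c a' b' c' →
    FirstReturn Face a b c s e → FirstReturn Face a' b' c' s e
  firstReturn-relabel (to , _) (here st (i , j , ne)) = here st (to i , to j , ne)
  firstReturn-relabel same@(_ , from) (there st nΩ r) =
    there st (λ (i , j , ne) → nΩ (from i , from j , ne)) (firstReturn-relabel same r)

  M4wrt-relabel : ∀ {Face a b c a' b' c' x y z} → SameFace a b c a' b' c' →
    M4wrt Face a b c x y z → M4wrt Face a' b' c' x y z
  M4wrt-relabel same (r₁ , r₂ , r₃ , r₄ , r₅ , r₆) =
    rl r₁ , rl r₂ , rl r₃ , rl r₄ , rl r₅ , rl r₆
    where rl = λ {s e} → firstReturn-relabel {s = s} {e = e} same

  private
    inclusion : ∀ {a b c a' b' c' : Fin m} →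
      InF a' b' c' a → InF a' b' c' b → InF a' b' c' c → ∀ {u} → InF a b c u → InF a' b' c' u
    inclusion ia ib ic (inj₁ refl)         = ia
    inclusion ia ib ic (inj₂ (inj₁ refl)) = ib
    inclusion ia ib ic (inj₂ (inj₂ refl)) = ic

    in₁ : ∀ {a b c : Fin m} → InF a b c a
    in₁ = inj₁ refl
    in₂ : ∀ {a b c : Fin m} → InF a b c b
    in₂ = inj₂ (inj₁ refl)
    in₃ : ∀ {a b c : Fin m} → InF a b c c
    in₃ = inj₂ (inj₂ refl)

  same-swap₁₂ : ∀ {a b c} → SameFace a b c b a c
  same-swap₁₂ = inclusion in₂ in₁ in₃ , inclusion in₂ in₁ in₃

  same-swap₂₃ : ∀ {a b c} → SameFace a b c a c b
  same-swap₂₃ = inclusion in₁ in₃ in₂ , inclusion in₁ in₃ in₂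

  same-rot : ∀ {a b c} → SameFace a b c c a b
  same-rot = inclusion in₂ in₃ in₁ , inclusion in₃ in₁ in₂

data Corner : Set where
  A B C : Corner

data Arrangement : Corner → Corner → Corner → Set where
  ABC : Arrangement A B C
  BCA : Arrangement B C A
  CAB : Arrangement C A B
  ACB : Arrangement A C B
  CBA : Arrangement C B A
  BAC : Arrangement B A C

arr-rot : ∀ {x y z} → Arrangement x y z → Arrangement y z x
arr-rot ABC = BCA
arr-rot BCA = CAB
arr-rot CAB = ABC
arr-rot ACB = CBA
arr-rot CBA = BAC
arr-rot BAC = ACB

arr-swap : ∀ {x y z} → Arrangement x y z → Arrangement x z y
arr-swap ABC = ACB
arr-swap BCA = BAC
arr-swap CAB = CBA
arr-swap ACB = ABC
arr-swap CBA = CAB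
arr-swap BAC = BCA

complete : ∀ y z → y ≢ z → Σ[ x ∈ Corner ] Arrangement x y z
complete A A y≢z = ⊥-elim (y≢z refl)
complete A B _   = C , CAB
complete A C _   = B , BAC
complete B A _   = C , CBA
complete B B y≢z = ⊥-elim (y≢z refl)
complete B C _   = A , ABC
complete C A _   = B , BCA
complete C B _   = A , ACB
complete C C y≢z = ⊥-elim (y≢z refl)

data Vertex : Set where
  corner : Corner → Vertex
  apex   : Vertex

inF? : ∀ {m} (a b c u : Fin m) → Dec (InF a b c u)
inF? a b c u = (u ≟ a) ⊎-dec (u ≟ b) ⊎-dec (u ≟ c)

MissesOne : Fin 4 → Fin 4 → Fin 4 → Set
MissesOne a b c = Σ[ d ∈ Fin 4 ] (¬ InF a b c d × (∀ u → ¬ InF a b c u → u ≡ d))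

-- (opaque: the decision procedure is only evaluated once, when this is checked)
opaque
  missing-vertex : ∀ a b c → TetFace a b c → MissesOne a b c
  missing-vertex = toWitness {a? = all? λ a → all? λ b → all? λ c → tetFace? a b c →-dec missesOne? a b c} tt
    where
    tetFace? : ∀ u v w → Dec (TetFace u v w)
    tetFace? u v w = ¬? (u ≟ v) ×-dec ¬? (v ≟ w) ×-dec ¬? (u ≟ w)
    missesOne? : ∀ a b c → Dec (MissesOne a b c)
    missesOne? a b c =
      any? λ d → ¬? (inF? a b c d) ×-dec all? λ u → ¬? (inF? a b c u) →-dec (u ≟ d)

-- The connected sum Γ #_g Γ' with g : a ↦ a', b ↦ b', c ↦ c'

module Gluing (Γ : Triangulation) (a b c : Fin (Triangulation.n Γ))
  (Fabc : Triangulation.Face Γ a b c)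
  (knot : ZKnotted (Triangulation.n Γ) (Triangulation.Face Γ))
  (mono : MonoIdentity (Triangulation.n Γ) (Triangulation.Face Γ) a b c)
  (a' b' c' : Fin 4) (tf : TetFace a' b' c')
  where
  open Triangulation Γ
  open Zigzags Γ
  open ConnSum n Face a b c a' b' c' a' b' c'

  private
    variable
      x y z : Corner

  κ : Corner → Fin n
  κ A = a
  κ B = b
  κ C = c

  κ-in : ∀ x → InF a b c (κ x)
  κ-in A = inj₁ refl
  κ-in B = inj₂ (inj₁ refl)
  κ-in C = inj₂ (inj₂ refl)

  corner-of : ∀ {u} → InF a b c u → Σ[ x ∈ Corner ] u ≡ κ x
  corner-of (inj₁ e)         = A , e
  corner-of (inj₂ (inj₁ e)) = B , e
  corner-of (inj₂ (inj₂ e)) = C , e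

  κ-face : Arrangement x y z → Face (κ x) (κ y) (κ z)
  κ-face ABC = Fabc
  κ-face BCA = face-rot Fabc
  κ-face CAB = face-rot² Fabc
  κ-face ACB = face-swap (face-rot² Fabc)
  κ-face CBA = face-swap (face-rot Fabc)
  κ-face BAC = face-swap Fabc

  κ-return : Arrangement x y z → FirstReturn Face a b c (κ x , κ y , κ z) (κ y , κ z)
  κ-return CAB = proj₁ mono
  κ-return ABC = proj₁ (proj₂ mono)
  κ-return BCA = proj₁ (proj₂ (proj₂ mono))
  κ-return BAC = proj₁ (proj₂ (proj₂ (proj₂ mono)))
  κ-return ACB = proj₁ (proj₂ (proj₂ (proj₂ (proj₂ mono))))
  κ-return CBA = proj₂ (proj₂ (proj₂ (proj₂ (proj₂ mono))))

  edge-of-F : ∀ {u v} → InF a b c u → InF a b c v → u ≢ v →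
              Σ[ x ∈ Corner ] Σ[ y ∈ Corner ] Σ[ z ∈ Corner ]
                (Arrangement x y z × u ≡ κ y × v ≡ κ z)
  edge-of-F iu iv u≢v with corner-of iu | corner-of iv
  ... | y , refl | z , refl with complete y z (λ y≡z → u≢v (cong κ y≡z))
  ... | x , arr = x , y , z , arr , refl , refl

  g : Corner → Fin 4
  g A = a'
  g B = b'
  g C = c'

  g-in : ∀ x → InF a' b' c' (g x)
  g-in A = inj₁ refl
  g-in B = inj₂ (inj₁ refl)
  g-in C = inj₂ (inj₂ refl)

  a'≢b' : a' ≢ b'
  a'≢b' = proj₁ tf

  b'≢c' : b' ≢ c'
  b'≢c' = proj₁ (proj₂ tf)

  a'≢c' : a' ≢ c'
  a'≢c' = proj₂ (proj₂ tf)

  g-face : Arrangement x y z → TetFace (g x) (g y) (g z)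
  g-face ABC = a'≢b' , b'≢c' , a'≢c'
  g-face BCA = b'≢c' , ≢-sym a'≢c' , ≢-sym a'≢b'
  g-face CAB = ≢-sym a'≢c' , a'≢b' , ≢-sym b'≢c'
  g-face ACB = a'≢c' , ≢-sym b'≢c' , a'≢b'
  g-face CBA = ≢-sym b'≢c' , ≢-sym a'≢b' , ≢-sym a'≢c'
  g-face BAC = ≢-sym a'≢b' , a'≢c' , b'≢c'

  d : Fin 4
  d = proj₁ (missing-vertex a' b' c' tf)

  d∉F' : ¬ InF a' b' c' d
  d∉F' = proj₁ (proj₂ (missing-vertex a' b' c' tf))

  only-d : ∀ u → ¬ InF a' b' c' u → u ≡ d
  only-d = proj₂ (proj₂ (missing-vertex a' b' c' tf))

  g≢d : ∀ x → g x ≢ d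
  g≢d x gx≡d = d∉F' (subst (InF a' b' c') gx≡d (g-in x))

  ι : Fin n → Fin (suc n)
  ι = inject₁

  D : Fin (suc n)
  D = fromℕ n

  ⟨_⟩ : Corner → Fin (suc n)
  ⟨ x ⟩ = ι (κ x)

  corner≢apex : ⟨ x ⟩ ≢ D
  corner≢apex e = fromℕ≢inject₁ (sym e)

  corners-distinct : κ x ≢ κ y → ⟨ x ⟩ ≢ ⟨ y ⟩
  corners-distinct κx≢κy e = κx≢κy (inject₁-injective e)

  private
    ⌊⌋-true : ∀ {P : Set} (p? : Dec P) → P → ⌊ p? ⌋ ≡ true
    ⌊⌋-true p? p = trans (isYes≗does p?) (dec-true p? p)

    ⌊⌋-false : ∀ {P : Set} (p? : Dec P) → ¬ P → ⌊ p? ⌋ ≡ false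
    ⌊⌋-false p? ¬p = trans (isYes≗does p?) (dec-false p? ¬p)

  φ-corner : ∀ x → φ (g x) ≡ ⟨ x ⟩
  φ-corner A rewrite ⌊⌋-true (a' ≟ a') refl = refl
  φ-corner B rewrite ⌊⌋-false (b' ≟ a') (≢-sym a'≢b')
                   | ⌊⌋-true (b' ≟ b') refl = refl
  φ-corner C rewrite ⌊⌋-false (c' ≟ a') (≢-sym a'≢c')
                   | ⌊⌋-false (c' ≟ b') (≢-sym b'≢c')
                   | ⌊⌋-true (c' ≟ c') refl = refl

  φ-d : φ d ≡ D
  φ-d rewrite ⌊⌋-false (d ≟ a') (λ e → d∉F' (inj₁ e))
            | ⌊⌋-false (d ≟ b') (λ e → d∉F' (inj₂ (inj₁ e)))
            | ⌊⌋-false (d ≟ c') (λ e → d∉F' (inj₂ (inj₂ e))) = refl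

  faceApexLast : g y ≢ g z → SumFace ⟨ y ⟩ ⟨ z ⟩ D
  faceApexLast {y} {z} gy≢gz = inj₂ (g y , g z , d , (gy≢gz , g≢d z , g≢d y) ,
    (λ (_ , _ , i) → d∉F' i) , sym (φ-corner y) , sym (φ-corner z) , sym φ-d)

  faceApexMiddle : g y ≢ g z → SumFace ⟨ y ⟩ D ⟨ z ⟩
  faceApexMiddle {y} {z} gy≢gz = inj₂ (g y , d , g z , (g≢d y , ≢-sym (g≢d z) , gy≢gz) ,
    (λ (_ , i , _) → d∉F' i) , sym (φ-corner y) , sym φ-d , sym (φ-corner z))

  faceApexFirst : g y ≢ g z → SumFace D ⟨ y ⟩ ⟨ z ⟩
  faceApexFirst {y} {z} gy≢gz = inj₂ (d , g y , g z , (≢-sym (g≢d y) , gy≢gz , ≢-sym (g≢d z)) ,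
    (λ (i , _ , _) → d∉F' i) , sym φ-d , sym (φ-corner y) , sym (φ-corner z))

  ⟦_⟧ : Flag n → Flag (suc n)
  ⟦ x , y , z ⟧ = ι x , ι y , ι z

  AllF : Flag n → Set
  AllF (x , y , z) = InF a b c x × InF a b c y × InF a b c z

  -- flags of faces other than F survive in the sum
  Outer : Flag n → Set
  Outer t = ¬ AllF t

  allF? : ∀ t → Dec (AllF t)
  allF? (x , y , z) = inF? a b c x ×-dec inF? a b c y ×-dec inF? a b c z

  outer-if-avoids : ∀ {t} → IsFlag Face t → AvoidsΩ a b c t → Outer t
  outer-if-avoids ft nΩ (_ , iy , iz) = nΩ (iy , iz , proj₁ (proj₂ (face-distinct ft)))

  SStep : Flag (suc n) → Flag (suc n) → Set
  SStep = Step SumFace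

  liftStep : ∀ {s t} → Step Face s t → Outer t → SStep ⟦ s ⟧ ⟦ t ⟧
  liftStep {x , y , z} {.y , .z , w} (refl , refl , fw , w≢x) o =
    refl , refl , inj₁ (y , z , w , fw , o , refl , refl , refl) , λ e → w≢x (inject₁-injective e)

  liftStepFromApex : ∀ {s t} → Step Face s t → Outer t → SStep (D , proj₂ ⟦ s ⟧) ⟦ t ⟧
  liftStepFromApex {x , y , z} {.y , .z , w} (refl , refl , fw , _) o =
    refl , refl , inj₁ (y , z , w , fw , o , refl , refl , refl) , λ e → fromℕ≢inject₁ (sym e)

  Lifted : Flag (suc n) → Set
  Lifted Y = Σ[ t ∈ Flag n ] (Y ≡ ⟦ t ⟧ × AvoidsΩ a b c t)

  -- The hypothesis on
  -- edge s guarantees that the returning flag still lies outside F.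
  liftReturn : ∀ {s e X} → FirstReturn Face a b c s e → IsFlag Face s →
    AvoidsΩ a b c s ⊎ e ≡ edge s → (∀ {t} → Step Face s t → Outer t → SStep X ⟦ t ⟧) →
    Σ[ t ∈ Flag n ] (Passage SumFace Lifted X ⟦ t ⟧ × edge t ≡ e)
  liftReturn {_ , s₂ , s₃} (here {t = t} st@(refl , refl , _ , _) iΩ) fs before lift =
    t , last (lift st outer) , refl
    where
    s₂≢s₃ = proj₁ (proj₂ (face-distinct fs))
    outer : Outer t
    outer (i₂ , _) = [ (λ nΩ → nΩ (i₂ , proj₁ iΩ , s₂≢s₃))
                     , (λ e≡es → s₂≢s₃ (sym (cong proj₁ e≡es))) ] before
  liftReturn (there {t = t} st nΩ r) fs before lift
    with liftReturn r (step-flag st) (inj₁ nΩ) liftStep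
  ... | t' , p , e = t' , (lift st outer , t , refl , nΩ) ∷ p , e
    where
    outer = outer-if-avoids (step-flag st) nΩ

  -- By M_F = id, the zigzag entering Γ from the apex through yz comes back through yz.
  crossΓ : Arrangement x y z →
           Σ[ t ∈ Fin n ] Passage SumFace Lifted (D , ⟨ y ⟩ , ⟨ z ⟩) (ι t , ⟨ y ⟩ , ⟨ z ⟩)
  crossΓ arr with liftReturn (κ-return arr) (κ-face arr) (inj₂ refl) liftStepFromApex
  ... | (t , _ , _) , p , refl = t , p

  enterApex : Arrangement x y z → ∀ t → SStep (ι t , ⟨ y ⟩ , ⟨ z ⟩) (⟨ y ⟩ , ⟨ z ⟩ , D)
  enterApex arr t = refl , refl , faceApexLast (proj₁ (proj₂ (g-face arr))) , fromℕ≢inject₁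

  stepOut : Arrangement x y z → SStep (⟨ x ⟩ , ⟨ y ⟩ , D) (⟨ y ⟩ , D , ⟨ z ⟩)
  stepOut arr = refl , refl , faceApexMiddle (proj₁ (proj₂ (g-face arr))) ,
    corners-distinct (≢-sym (proj₂ (proj₂ (face-distinct (κ-face arr)))))

  stepIn : Arrangement x y z → SStep (⟨ x ⟩ , D , ⟨ y ⟩) (D , ⟨ y ⟩ , ⟨ z ⟩)
  stepIn arr = refl , refl , faceApexFirst (proj₁ (proj₂ (g-face arr))) ,
    corners-distinct (≢-sym (proj₂ (proj₂ (face-distinct (κ-face arr)))))

  crossing : Arrangement x y z → Star SStep (D , ⟨ y ⟩ , ⟨ z ⟩) (⟨ y ⟩ , ⟨ z ⟩ , D)
  crossing arr = let (t , p) = crossΓ arr in passage-star p ◅◅ (enterApex arr t ◅ ε)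

  turn : Arrangement x y z → Star SStep (⟨ x ⟩ , ⟨ y ⟩ , D) (D , ⟨ z ⟩ , ⟨ x ⟩)
  turn arr = stepOut arr ◅ stepIn (arr-rot arr) ◅ ε

  around : Arrangement x y z → Star SStep (D , ⟨ y ⟩ , ⟨ z ⟩) (D , ⟨ x ⟩ , ⟨ y ⟩)
  around arr = crossing arr ◅◅ turn (arr-rot arr)

  base : Flag (suc n)
  base = D , ⟨ A ⟩ , ⟨ B ⟩

  Reach : Flag (suc n) → Set
  Reach P = Star SStep base P ⊎ Star SStep (rev base) P

  reach-extend : ∀ {P Q} → Reach P → Star SStep P Q → Reach Q
  reach-extend (inj₁ p) q = inj₁ (p ◅◅ q)
  reach-extend (inj₂ p) q = inj₂ (p ◅◅ q)

  -- the apex flags: three on the zigzag of base, three on that of its reverse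
  reachApexFirst : Arrangement x y z → Reach (D , ⟨ y ⟩ , ⟨ z ⟩)
  reachApexFirst CAB = inj₁ ε
  reachApexFirst BCA = inj₁ (around CAB)
  reachApexFirst ABC = inj₁ (around CAB ◅◅ around BCA)
  reachApexFirst ACB = inj₂ (turn BAC)
  reachApexFirst BAC = inj₂ (turn BAC ◅◅ around ACB)
  reachApexFirst CBA = inj₂ (turn BAC ◅◅ around ACB ◅◅ around BAC)

  reachApexLast : Arrangement x y z → Reach (⟨ y ⟩ , ⟨ z ⟩ , D)
  reachApexLast arr = reach-extend (reachApexFirst arr) (crossing arr)

  reachApexMiddle : Arrangement x y z → Reach (⟨ y ⟩ , D , ⟨ z ⟩)
  reachApexMiddle arr = reach-extend (reachApexLast (arr-rot (arr-rot arr))) (stepOut arr ◅ ε)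

  -- Old flags are reached by following Γ's zigzags, which leave F through the apex.

  -- invariant along a zigzag of Γ: a flag of F, or an outer flag already reached
  Visited : Flag n → Set
  Visited t = AllF t ⊎ (Outer t × Reach ⟦ t ⟧)

  -- leaving F, the zigzag of Γ continues in the sum from an apex flag (D,y,z)
  leaveF : ∀ {u v} → IsFlag Face u → AllF u → Step Face u v → Outer v → Reach ⟦ v ⟧
  leaveF {u} fu (_ , i₂ , i₃) st o with edge-of-F i₂ i₃ (proj₁ (proj₂ (face-distinct fu)))
  ... | _ , _ , _ , arr , refl , refl =
    reach-extend (reachApexFirst arr) (liftStepFromApex {s = u} st o ◅ ε)

  visited-step : ∀ {u v} → IsFlag Face u → Visited u → Step Face u v → Visited v
  visited-step {v = v} fu vis st with allF? v | vis
  ... | yes allv | _              = inj₁ allv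
  ... | no o     | inj₁ allu      = inj₂ (o , leaveF fu allu st o)
  ... | no o     | inj₂ (_ , r)   = inj₂ (o , reach-extend r (liftStep st o ◅ ε))

  visited-path : ∀ {u v} → IsFlag Face u → Visited u → Star (Step Face) u v → Visited v
  visited-path fu vis ε        = vis
  visited-path fu vis (st ◅ p) = visited-path (step-flag st) (visited-step fu vis st) p

  reachOuter : ∀ {t} → IsFlag Face t → Outer t → Reach ⟦ t ⟧
  reachOuter {t} ft o = reached (from-F (knotted-connects knot Fabc ft))
    where
    from-F : Star (Step Face) (a , b , c) t ⊎ Star (Step Face) (c , b , a) t → Visited t
    from-F (inj₁ p) = visited-path Fabc (inj₁ (κ-in A , κ-in B , κ-in C)) p
    from-F (inj₂ p) = visited-path (rev-flag Fabc) (inj₁ (κ-in C , κ-in B , κ-in A)) p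
    reached : Visited t → Reach ⟦ t ⟧
    reached (inj₁ all)     = ⊥-elim (o all)
    reached (inj₂ (_ , r)) = r

  data NewFlag : Fin (suc n) → Fin (suc n) → Fin (suc n) → Set where
    apexFirst  : Arrangement x y z → NewFlag D ⟨ y ⟩ ⟨ z ⟩
    apexMiddle : Arrangement x y z → NewFlag ⟨ y ⟩ D ⟨ z ⟩
    apexLast   : Arrangement x y z → NewFlag ⟨ y ⟩ ⟨ z ⟩ D

  τ : Vertex → Fin 4
  τ (corner x) = g x
  τ apex       = d

  ⟪_⟫ : Vertex → Fin (suc n)
  ⟪ corner x ⟫ = ⟨ x ⟩
  ⟪ apex ⟫     = D

  φ-τ : ∀ p → φ (τ p) ≡ ⟪ p ⟫
  φ-τ (corner x) = φ-corner x
  φ-τ apex       = φ-d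

  vertex-of : ∀ u → Σ[ p ∈ Vertex ] u ≡ τ p
  vertex-of u with inF? a' b' c' u
  ... | yes (inj₁ e)         = corner A , e
  ... | yes (inj₂ (inj₁ e)) = corner B , e
  ... | yes (inj₂ (inj₂ e)) = corner C , e
  ... | no u∉F'              = apex , only-d u u∉F'

  -- a face of the tetrahedron other than F' contains d exactly once
  classify : ∀ p q r → TetFace (τ p) (τ q) (τ r) →
             ¬ (InF a' b' c' (τ p) × InF a' b' c' (τ q) × InF a' b' c' (τ r)) →
             NewFlag ⟪ p ⟫ ⟪ q ⟫ ⟪ r ⟫
  classify (corner x) (corner y) (corner z) _ notF' = ⊥-elim (notF' (g-in x , g-in y , g-in z))
  classify (corner y) (corner z) apex (gy≢gz , _) _ =
    apexLast (proj₂ (complete y z (λ y≡z → gy≢gz (cong g y≡z))))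
  classify (corner y) apex (corner z) (_ , _ , gy≢gz) _ =
    apexMiddle (proj₂ (complete y z (λ y≡z → gy≢gz (cong g y≡z))))
  classify apex (corner y) (corner z) (_ , gy≢gz , _) _ =
    apexFirst (proj₂ (complete y z (λ y≡z → gy≢gz (cong g y≡z))))
  classify (corner _) apex apex (_ , d≢d , _) _ = ⊥-elim (d≢d refl)
  classify apex (corner _) apex (_ , _ , d≢d) _ = ⊥-elim (d≢d refl)
  classify apex apex _ (d≢d , _) _             = ⊥-elim (d≢d refl)

  newFlag : ∀ {u v w} → TetFace u v w → ¬ (InF a' b' c' u × InF a' b' c' v × InF a' b' c' w) →
            NewFlag (φ u) (φ v) (φ w)
  newFlag {u} {v} {w} tuvw notF' with vertex-of u | vertex-of v | vertex-of w
  ... | p , refl | q , refl | r , refl rewrite φ-τ p | φ-τ q | φ-τ r = classify p q r tuvw notF'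

  reachNew : ∀ {P Q R} → NewFlag P Q R → Reach (P , Q , R)
  reachNew (apexFirst arr)  = reachApexFirst arr
  reachNew (apexMiddle arr) = reachApexMiddle arr
  reachNew (apexLast arr)   = reachApexLast arr

  sum-knotted : ZKnotted (suc n) SumFace
  sum-knotted = base , faceApexFirst a'≢b' , reach
    where
    reach : ∀ t → IsFlag SumFace t → Reach t
    reach _ (inj₁ (_ , _ , _ , fuvw , outer , refl , refl , refl)) = reachOuter fuvw outer
    reach _ (inj₂ (_ , _ , _ , tuvw , notF' , refl , refl , refl)) = reachNew (newFlag tuvw notF')

  -- Monodromy of the new face G = {y , z , D} for an arrangement (x , y , z).

  old-in-new : ∀ {u} → InF ⟨ y ⟩ ⟨ z ⟩ D (ι u) → InF a b c u
  old-in-new {y} (inj₁ e)         = subst (InF a b c) (sym (inject₁-injective e)) (κ-in y)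
  old-in-new {z = z} (inj₂ (inj₁ e)) = subst (InF a b c) (sym (inject₁-injective e)) (κ-in z)
  old-in-new (inj₂ (inj₂ e)) = ⊥-elim (fromℕ≢inject₁ (sym e))

  lifted-avoids : ∀ {Y} → Lifted Y → AvoidsΩ ⟨ y ⟩ ⟨ z ⟩ D Y
  lifted-avoids (_ , refl , nΩ) (i , j , ne) = nΩ (old-in-new i , old-in-new j , λ e → ne (cong ι e))

  module ApexFace (arr : Arrangement x y z) where

    G-returns : Flag (suc n) → Fin (suc n) × Fin (suc n) → Set
    G-returns = FirstReturn SumFace ⟨ y ⟩ ⟨ z ⟩ D

    -- the missing corner x is not on G, so edges through it avoid Ω(G)
    x∉G : ¬ InF ⟨ y ⟩ ⟨ z ⟩ D ⟨ x ⟩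
    x∉G (inj₁ e)         = proj₁ (face-distinct (κ-face arr)) (inject₁-injective e)
    x∉G (inj₂ (inj₁ e)) = proj₂ (proj₂ (face-distinct (κ-face arr))) (inject₁-injective e)
    x∉G (inj₂ (inj₂ e)) = corner≢apex e

    avoids-from-x : ∀ {Q} → ¬ InΩ ⟨ y ⟩ ⟨ z ⟩ D (⟨ x ⟩ , Q)
    avoids-from-x (i , _ , _) = x∉G i

    avoids-to-x : ∀ {P} → ¬ InΩ ⟨ y ⟩ ⟨ z ⟩ D (P , ⟨ x ⟩)
    avoids-to-x (_ , j , _) = x∉G j

    y≢z : ⟨ y ⟩ ≢ ⟨ z ⟩
    y≢z = corners-distinct (proj₁ (proj₂ (face-distinct (κ-face arr))))

    -- M_G(yz) = yz: straight across Γ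
    returnAcross : G-returns (D , ⟨ y ⟩ , ⟨ z ⟩) (⟨ y ⟩ , ⟨ z ⟩)
    returnAcross = firstReturn-at (passage-map lifted-avoids (proj₂ (crossΓ arr)))
                     (inj₁ refl , inj₂ (inj₁ refl) , y≢z)

    -- M_G(zD) = yD: around the apex, across Γ through xy, back into the apex
    returnToApexEdge : G-returns (⟨ y ⟩ , ⟨ z ⟩ , D) (⟨ y ⟩ , D)
    returnToApexEdge =
      there (stepOut (arr-rot arr)) avoids-to-x $
      there (stepIn arr₂) avoids-from-x $
      firstReturn-through (passage-map lifted-avoids p) avoids-from-x $
      here (enterApex arr₂ t) (inj₁ refl , inj₂ (inj₂ refl) , corner≢apex)
      where
      arr₂ = arr-rot (arr-rot arr)
      t = proj₁ (crossΓ arr₂)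
      p = proj₂ (crossΓ arr₂)

    -- M_G(Dz) = Dy: into the apex, across Γ through zx, back around the apex
    returnFromApex : G-returns (⟨ y ⟩ , D , ⟨ z ⟩) (D , ⟨ y ⟩)
    returnFromApex =
      there (stepIn (arr-rot arr)) avoids-to-x $
      firstReturn-through (passage-map lifted-avoids p) avoids-to-x $
      there (enterApex (arr-rot arr) t) avoids-from-x $
      here (stepOut (arr-rot (arr-rot arr))) (inj₂ (inj₂ refl) , inj₁ refl , ≢-sym corner≢apex)
      where
      t = proj₁ (crossΓ (arr-rot arr))
      p = proj₂ (crossΓ (arr-rot arr))

  -- each new face is of type (M4) with e₁ = zD, e₂ = Dy, e₃ = yz
  apexFaceM4 : Arrangement x y z → M4wrt SumFace ⟨ y ⟩ ⟨ z ⟩ D ⟨ z ⟩ D ⟨ y ⟩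
  apexFaceM4 arr =
    G.returnToApexEdge ,
    firstReturn-relabel same-swap₁₂ G'.returnToApexEdge ,
    firstReturn-relabel same-swap₁₂ G'.returnFromApex ,
    G.returnFromApex ,
    G.returnAcross ,
    firstReturn-relabel same-swap₁₂ G'.returnAcross
    where
    module G  = ApexFace arr
    module G' = ApexFace (arr-swap arr)

  typeM4-new : ∀ {P Q R} → NewFlag P Q R → TypeM4 (suc n) SumFace P Q R
  typeM4-new (apexLast arr)   = inj₂ (inj₁ (apexFaceM4 arr))
  typeM4-new (apexFirst arr)  = inj₂ (inj₂ (inj₁ (M4wrt-relabel same-rot (apexFaceM4 arr))))
  typeM4-new (apexMiddle arr) =
    inj₂ (inj₂ (inj₂ (inj₂ (inj₁ (M4wrt-relabel same-swap₂₃ (apexFaceM4 arr))))))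

  new-faces-M4 : ∀ u v w → TetFace u v w → ¬ (InF a' b' c' u × InF a' b' c' v × InF a' b' c' w) →
                 TypeM4 (suc n) SumFace (φ u) (φ v) (φ w)
  new-faces-M4 _ _ _ tuvw notF' = typeM4-new (newFlag tuvw notF')

proposition1 : (Γ : Triangulation) → (a b c : Fin (Triangulation.n Γ)) →
    Triangulation.Face Γ a b c →
    ZKnotted (Triangulation.n Γ) (Triangulation.Face Γ) →
    MonoIdentity (Triangulation.n Γ) (Triangulation.Face Γ) a b c →
    (a' b' c' : Fin 4) → TetFace a' b' c' →
    Σ[ p ∈ Fin 4 ] Σ[ q ∈ Fin 4 ] Σ[ r ∈ Fin 4 ]
      (IsBij a' b' c' p q r ×
       ZKnotted (suc (Triangulation.n Γ))
         (ConnSum.SumFace (Triangulation.n Γ) (Triangulation.Face Γ) a b c a' b' c' p q r) ×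
       (∀ u v w → TetFace u v w → ¬ (InF a' b' c' u × InF a' b' c' v × InF a' b' c' w) →
         TypeM4 (suc (Triangulation.n Γ))
           (ConnSum.SumFace (Triangulation.n Γ) (Triangulation.Face Γ) a b c a' b' c' p q r)
           (ConnSum.φ (Triangulation.n Γ) (Triangulation.Face Γ) a b c a' b' c' p q r u)
           (ConnSum.φ (Triangulation.n Γ) (Triangulation.Face Γ) a b c a' b' c' p q r v)
           (ConnSum.φ (Triangulation.n Γ) (Triangulation.Face Γ) a b c a' b' c' p q r w)))
proposition1 Γ a b c Fabc knot mono a' b' c' tf =
  a' , b' , c' , (tf , inj₁ refl , inj₂ (inj₁ refl) , inj₂ (inj₂ refl)) , sum-knotted , new-faces-M4
  where open Gluing Γ a b c Fabc knot mono a' b' c' tf
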